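{- For integers $n$ and $r\ge0$, let $C^{(r)}_n$ be the number of tilings of a $(2n+1)$-board using squares and $(1,1)$-fences that use exactly $2r+1$ squares (and hence $n-r$ fences), with $C^{(r)}_n=0$ for $n<0$. Then for all integers $n\ge r\ge0$, \[ C^{(r)}_n=C^{(r)}_{n-2}+\binom{n+r}{2r}. \]
   Context: An $N$-board is a $1\times N$ row of $N$ unit cells. A square is a $1\times1$ tile. A $(1,1)$-fence is a tile consisting of two $1\times1$ posts separated by a one-cell gap; placed on a board its posts occupy cells $i$ and $i+2$, and the gap cell must be covered by another tile. A tiling covers every cell exactly once. -}

module Defs where

open import Data.Nat using (ℕ; zero; suc; _+_; _<_; _<?_)
open import Data.Nat.Properties using (_≟_)
open import Data.Integer using (ℤ; +_; -[1+_])
open import Data.Bool using (Bool; true; false)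
open import Data.Bool.Properties using () renaming (_≟_ to _≟ᵇ_)
open import Data.Fin using (Fin; toℕ)
open import Data.Fin.Properties using (all?)
open import Data.Vec using (Vec; []; _∷_; lookup)
open import Data.List using (List; []; _∷_; [_]; concatMap; cartesianProduct; filter; length)
open import Data.Product using (_×_; _,_; proj₁; proj₂)
open import Relation.Binary.PropositionalEquality using (_≡_)
open import Relation.Nullary using (Dec)
open import Relation.Nullary.Decidable using (_×-dec_; _→-dec_)

-- Cells of the N-board are 0,…,N-1.
-- A set of tile placements on the N-board is recorded by two bit-vectors:
--   sq i = true  : a square occupies cell i
--   fe i = true  : a (1,1)-fence has its posts on cells i and i+2
-- (a tiling is a set of placed tiles, so this representation is exact).

at : ∀ {N} → Vec Bool N → ℕ → Bool
at []       _       = false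
at (b ∷ v)  zero    = b
at (b ∷ v)  (suc i) = at v i

b2n : Bool → ℕ
b2n true  = 1
b2n false = 0

cover : ∀ {N} → Vec Bool N → Vec Bool N → ℕ → ℕ
cover sq fe c = b2n (at sq c) + b2n (at fe c) + fencePostLeft c
  where
  fencePostLeft : ℕ → ℕ
  fencePostLeft zero          = 0
  fencePostLeft (suc zero)    = 0
  fencePostLeft (suc (suc d)) = b2n (at fe d)   -- right post of fence starting at c-2

IsTiling : (N : ℕ) → Vec Bool N × Vec Bool N → Set
IsTiling N (sq , fe) =
  ((i : Fin N) → lookup fe i ≡ true → toℕ i + 2 < N) ×
  ((c : Fin N) → cover sq fe (toℕ c) ≡ 1)

numSquares : ∀ {N} → Vec Bool N → ℕ
numSquares []          = 0
numSquares (true ∷ v)  = suc (numSquares v)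
numSquares (false ∷ v) = numSquares v

IsTilingWith : (N k : ℕ) → Vec Bool N × Vec Bool N → Set
IsTilingWith N k t = IsTiling N t × (numSquares (proj₁ t) ≡ k)

isTilingWith? : (N k : ℕ) → (t : Vec Bool N × Vec Bool N) → Dec (IsTilingWith N k t)
isTilingWith? N k (sq , fe) =
  ((all? (λ i → (lookup fe i ≟ᵇ true) →-dec (toℕ i + 2 <? N)))
    ×-dec all? (λ c → cover sq fe (toℕ c) ≟ 1))
  ×-dec (numSquares sq ≟ k)

allVecs : (N : ℕ) → List (Vec Bool N)
allVecs zero    = [ [] ]
allVecs (suc N) = concatMap (λ v → (true ∷ v) ∷ (false ∷ v) ∷ []) (allVecs N)

numTilings : (N k : ℕ) → ℕ
numTilings N k = length (filter (isTilingWith? N k) (cartesianProduct (allVecs N) (allVecs N)))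

Cᵣ : (r : ℕ) → ℤ → ℕ
Cᵣ r (+ n)      = numTilings (suc (n + n)) (suc (r + r))
Cᵣ r -[1+ _ ]   = 0

-- Reading a tiling from left to right, each tile is a square, a fence with a
-- square in its gap, or a fence whose gap is the left post of a second fence
-- that interlocks with it; so a tiling is a sequence of blocks of lengths 1, 3
-- and 4 carrying 1, 1 and 0 squares.  On the (2n+1)-board, peeling off the
-- first block gives C⁽ʳ⁾ₙ = C⁽ʳ⁾ₙ₋₂ + B(2n) + B(2n-2), where B(N) counts the
-- block tilings of the N-board with 2r squares.  The sum B(N+2) + B(N) obeys
-- the square/domino recurrence, so it counts square/domino tilings, of which
-- the (2n)-board with 2r squares has C(n+r, 2r).

module Submission where

open import Defs
open import Data.Bool using (Bool; true; false; T; _∧_)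
open import Data.Fin using (Fin; toℕ) renaming (zero to fzero; suc to fsuc)
open import Data.Integer using (+_; _-_)
open import Data.List using (List; []; _∷_; _++_; map; concatMap; cartesianProduct; filter; length)
open import Data.Nat using (ℕ; zero; suc; _+_; _*_; _≤_; _<_; z≤n; s≤s)
open import Data.Nat.Combinatorics using (_C_; nCn≡1; nCk+nC[k+1]≡[n+1]C[k+1])
open import Data.Nat.Properties
  using (+-assoc; +-comm; +-suc; +-identityʳ; ≤-pred; suc-injective; m≤n⇒∃[o]m+o≡n; +-commutativeSemigroup)
open import Algebra.Properties.CommutativeSemigroup +-commutativeSemigroup using (interchange)
open import Data.Nat.Tactic.RingSolver using (solve-∀)
open import Data.Product using (_×_; _,_; proj₂)
open import Data.Vec using (Vec; []; _∷_; lookup)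
open import Function.Bundles using (_⇔_; mk⇔; Equivalence)
open import Relation.Binary.PropositionalEquality
  using (_≡_; refl; sym; trans; cong; cong₂; module ≡-Reasoning)
open import Relation.Nullary using (does)
open import Relation.Nullary.Decidable using (does-⇔; T?)
open import Relation.Unary using (Decidable)

open Equivalence using (to; from)

private variable
  A B : Set

∑ : List A → (A → ℕ) → ℕ
∑ []       f = 0
∑ (x ∷ xs) f = f x + ∑ xs f

syntax ∑ xs (λ x → e) = ∑[ x ∈ xs ] e

∑-cong : {f g : A → ℕ} → (∀ x → f x ≡ g x) → ∀ xs → ∑ xs f ≡ ∑ xs g
∑-cong f≗g []       = refl
∑-cong f≗g (x ∷ xs) = cong₂ _+_ (f≗g x) (∑-cong f≗g xs)

∑-++ : (f : A → ℕ) (xs ys : List A) → ∑ (xs ++ ys) f ≡ ∑ xs f + ∑ ys f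
∑-++ f []       ys = refl
∑-++ f (x ∷ xs) ys = trans (cong (_+_ (f x)) (∑-++ f xs ys)) (sym (+-assoc (f x) _ _))

∑-+ : (f g : A → ℕ) (xs : List A) → ∑ xs f + ∑ xs g ≡ ∑[ x ∈ xs ] (f x + g x)
∑-+ f g []       = refl
∑-+ f g (x ∷ xs) =
  trans (interchange (f x) (∑ xs f) (g x) (∑ xs g)) (cong (_+_ (f x + g x)) (∑-+ f g xs))

∑-map : (f : B → ℕ) (g : A → B) (xs : List A) → ∑ (map g xs) f ≡ ∑[ x ∈ xs ] f (g x)
∑-map f g []       = refl
∑-map f g (x ∷ xs) = cong (_+_ (f (g x))) (∑-map f g xs)

∑-concatMap : (f : B → ℕ) (g : A → List B) (xs : List A) →
              ∑ (concatMap g xs) f ≡ ∑[ x ∈ xs ] ∑ (g x) f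
∑-concatMap f g []       = refl
∑-concatMap f g (x ∷ xs) = trans (∑-++ f (g x) _) (cong (_+_ (∑ (g x) f)) (∑-concatMap f g xs))

∑-cartesianProduct : (h : A × B → ℕ) (xs : List A) (ys : List B) →
                     ∑ (cartesianProduct xs ys) h ≡ ∑[ x ∈ xs ] ∑[ y ∈ ys ] h (x , y)
∑-cartesianProduct h []       ys = refl
∑-cartesianProduct h (x ∷ xs) ys =
  trans (∑-++ h (map (x ,_) ys) _) (cong₂ _+_ (∑-map h (x ,_) ys) (∑-cartesianProduct h xs ys))

length-filter≡∑ : {P : A → Set} (P? : Decidable P) (xs : List A) →
                  length (filter P? xs) ≡ ∑[ x ∈ xs ] b2n (does (P? x))
length-filter≡∑ P? []       = refl
length-filter≡∑ P? (x ∷ xs) with does (P? x)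
... | true  = cong suc (length-filter≡∑ P? xs)
... | false = length-filter≡∑ P? xs

∑-allVecs : ∀ N (f : Vec Bool (suc N) → ℕ) →
            ∑ (allVecs (suc N)) f ≡ ∑[ v ∈ allVecs N ] (f (true ∷ v) + f (false ∷ v))
∑-allVecs N f =
  trans (∑-concatMap f _ (allVecs N))
        (∑-cong (λ v → cong (_+_ (f (true ∷ v))) (+-identityʳ _)) (allVecs N))

∑Pairs : (N : ℕ) → (Vec Bool N → Vec Bool N → ℕ) → ℕ
∑Pairs N h = ∑[ x ∈ allVecs N ] ∑[ y ∈ allVecs N ] h x y

∑Pairs-cong : ∀ N {h h′ : Vec Bool N → Vec Bool N → ℕ} →
              (∀ x y → h x y ≡ h′ x y) → ∑Pairs N h ≡ ∑Pairs N h′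
∑Pairs-cong N h≗h′ = ∑-cong (λ x → ∑-cong (h≗h′ x) (allVecs N)) (allVecs N)

∑Pairs-+ : ∀ N (h h′ : Vec Bool N → Vec Bool N → ℕ) →
           ∑Pairs N h + ∑Pairs N h′ ≡ ∑Pairs N (λ x y → h x y + h′ x y)
∑Pairs-+ N h h′ =
  trans (∑-+ _ _ (allVecs N)) (∑-cong (λ x → ∑-+ (h x) (h′ x) (allVecs N)) (allVecs N))

∑Pairs-∷ : ∀ N (h : Vec Bool (suc N) → Vec Bool (suc N) → ℕ) →
           ∑Pairs (suc N) h ≡
           ∑Pairs N (λ x y → (h (true ∷ x) (true ∷ y) + h (true ∷ x) (false ∷ y))
                           + (h (false ∷ x) (true ∷ y) + h (false ∷ x) (false ∷ y)))
∑Pairs-∷ N h = trans (∑-allVecs N _) (∑-cong (λ x →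
  trans (cong₂ _+_ (∑-allVecs N (h (true ∷ x))) (∑-allVecs N (h (false ∷ x))))
        (∑-+ _ _ (allVecs N))) (allVecs N))

-- A board whose cells 0 and 1 already carry the right posts p₀, p₁ of fences
-- placed to its left: the state reached after tiling a prefix of a longer board.
coverAfter : ∀ {N} → Bool → Bool → Vec Bool N → Vec Bool N → ℕ → ℕ
coverAfter p₀ p₁ sq fe c = b2n (at sq c) + b2n (at fe c) + rightPost c
  where
  rightPost : ℕ → ℕ
  rightPost zero          = b2n p₀
  rightPost (suc zero)    = b2n p₁
  rightPost (suc (suc d)) = b2n (at fe d)

cover≡coverAfter : ∀ {N} (sq fe : Vec Bool N) c → cover sq fe c ≡ coverAfter false false sq fe c
cover≡coverAfter sq fe zero          = refl
cover≡coverAfter sq fe (suc zero)    = refl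
cover≡coverAfter sq fe (suc (suc c)) = refl

coverAfter-∷ : ∀ {N} p₀ p₁ s f (sq fe : Vec Bool N) c →
               coverAfter p₀ p₁ (s ∷ sq) (f ∷ fe) (suc c) ≡ coverAfter p₁ f sq fe c
coverAfter-∷ p₀ p₁ s f sq fe zero          = refl
coverAfter-∷ p₀ p₁ s f sq fe (suc zero)    = refl
coverAfter-∷ p₀ p₁ s f sq fe (suc (suc c)) = refl

FencesInside : (N : ℕ) → Vec Bool N → Set
FencesInside N fe = (i : Fin N) → lookup fe i ≡ true → toℕ i + 2 < N

CoveredOnceAfter : (N : ℕ) → Bool → Bool → Vec Bool N → Vec Bool N → Set
CoveredOnceAfter N p₀ p₁ sq fe = (c : Fin N) → coverAfter p₀ p₁ sq fe (toℕ c) ≡ 1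

IsTilingAfter : (N : ℕ) → Bool → Bool → ℕ → Vec Bool N → Vec Bool N → Set
IsTilingAfter N p₀ p₁ k sq fe =
  FencesInside N fe × CoveredOnceAfter N p₀ p₁ sq fe × numSquares sq ≡ k

FencesInside-∷ : ∀ {N} f (fe : Vec Bool N) →
                 FencesInside (suc N) (f ∷ fe) ⇔ ((f ≡ true → 2 < suc N) × FencesInside N fe)
FencesInside-∷ f fe = mk⇔
  (λ inside → (inside fzero) , λ i fe[i] → ≤-pred (inside (fsuc i) fe[i]))
  (λ { (head , inside) fzero → head ; (head , inside) (fsuc i) fe[i] → s≤s (inside i fe[i]) })

CoveredOnceAfter-∷ : ∀ {N} p₀ p₁ s f (sq fe : Vec Bool N) →
                     CoveredOnceAfter (suc N) p₀ p₁ (s ∷ sq) (f ∷ fe)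
                     ⇔ (b2n s + b2n f + b2n p₀ ≡ 1 × CoveredOnceAfter N p₁ f sq fe)
CoveredOnceAfter-∷ p₀ p₁ s f sq fe = mk⇔
  (λ once → once fzero , λ c → trans (sym (coverAfter-∷ p₀ p₁ s f sq fe (toℕ c))) (once (fsuc c)))
  (λ { (head , once) fzero → head
     ; (head , once) (fsuc c) → trans (coverAfter-∷ p₀ p₁ s f sq fe (toℕ c)) (once c) })

fenceFits : ℕ → Bool
fenceFits (suc (suc _)) = true
fenceFits _             = false

-- The fence clause precedes the square clause so that applications to a
-- variable square count k still unfold on the first cell.
isTilingAfterᵇ : (N : ℕ) → Bool → Bool → ℕ → Vec Bool N → Vec Bool N → Bool
isTilingAfterᵇ zero    _     _  zero    []           []           = true
isTilingAfterᵇ (suc N) true  p₁ k       (false ∷ sq) (false ∷ fe) = isTilingAfterᵇ N p₁ false k sq fe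
isTilingAfterᵇ (suc N) false p₁ k       (false ∷ sq) (true ∷ fe)  =
  fenceFits N ∧ isTilingAfterᵇ N p₁ true k sq fe
isTilingAfterᵇ (suc N) false p₁ (suc k) (true ∷ sq)  (false ∷ fe) = isTilingAfterᵇ N p₁ false k sq fe
isTilingAfterᵇ _       _     _  _       _            _            = false

isTilingAfterᵇ-sound : ∀ N p₀ p₁ k sq fe →
                       T (isTilingAfterᵇ N p₀ p₁ k sq fe) → IsTilingAfter N p₀ p₁ k sq fe
isTilingAfterᵇ-sound zero _ _ zero [] [] _ = (λ ()) , (λ ()) , refl
isTilingAfterᵇ-sound (suc N) true p₁ k (false ∷ sq) (false ∷ fe) t
  with inside , once , squares ← isTilingAfterᵇ-sound N p₁ false k sq fe t =
  from (FencesInside-∷ false fe) ((λ ()) , inside) ,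
  from (CoveredOnceAfter-∷ true p₁ false false sq fe) (refl , once) , squares
isTilingAfterᵇ-sound (suc (suc (suc N))) false p₁ k (false ∷ sq) (true ∷ fe) t
  with inside , once , squares ← isTilingAfterᵇ-sound (suc (suc N)) p₁ true k sq fe t =
  from (FencesInside-∷ true fe) ((λ _ → s≤s (s≤s (s≤s z≤n))) , inside) ,
  from (CoveredOnceAfter-∷ false p₁ false true sq fe) (refl , once) , squares
isTilingAfterᵇ-sound (suc N) false p₁ (suc k) (true ∷ sq) (false ∷ fe) t
  with inside , once , squares ← isTilingAfterᵇ-sound N p₁ false k sq fe t =
  from (FencesInside-∷ false fe) ((λ ()) , inside) ,
  from (CoveredOnceAfter-∷ false p₁ true false sq fe) (refl , once) , cong suc squares
isTilingAfterᵇ-sound zero _ _ (suc k) [] [] ()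
isTilingAfterᵇ-sound (suc N) true p₁ k (false ∷ sq) (true ∷ fe) ()
isTilingAfterᵇ-sound (suc N) true p₁ k (true ∷ sq) (f ∷ fe) ()
isTilingAfterᵇ-sound (suc zero) false p₁ k (false ∷ sq) (true ∷ fe) ()
isTilingAfterᵇ-sound (suc (suc zero)) false p₁ k (false ∷ sq) (true ∷ fe) ()
isTilingAfterᵇ-sound (suc N) false p₁ k (false ∷ sq) (false ∷ fe) ()
isTilingAfterᵇ-sound (suc N) false p₁ zero (true ∷ sq) (f ∷ fe) ()
isTilingAfterᵇ-sound (suc N) false p₁ (suc k) (true ∷ sq) (true ∷ fe) ()

isTilingAfterᵇ-complete : ∀ N p₀ p₁ k sq fe →
                          IsTilingAfter N p₀ p₁ k sq fe → T (isTilingAfterᵇ N p₀ p₁ k sq fe)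
isTilingAfterᵇ-complete zero _ _ zero [] [] _ = _
isTilingAfterᵇ-complete zero _ _ (suc k) [] [] (_ , _ , ())
isTilingAfterᵇ-complete (suc N) true p₁ k (false ∷ sq) (false ∷ fe) (inside , once , squares) =
  isTilingAfterᵇ-complete N p₁ false k sq fe
    (proj₂ (to (FencesInside-∷ false fe) inside) ,
     proj₂ (to (CoveredOnceAfter-∷ true p₁ false false sq fe) once) , squares)
isTilingAfterᵇ-complete (suc (suc (suc N))) false p₁ k (false ∷ sq) (true ∷ fe) (inside , once , squares) =
  isTilingAfterᵇ-complete (suc (suc N)) p₁ true k sq fe
    (proj₂ (to (FencesInside-∷ true fe) inside) ,
     proj₂ (to (CoveredOnceAfter-∷ false p₁ false true sq fe) once) , squares)
isTilingAfterᵇ-complete (suc N) false p₁ (suc k) (true ∷ sq) (false ∷ fe) (inside , once , squares) =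
  isTilingAfterᵇ-complete N p₁ false k sq fe
    (proj₂ (to (FencesInside-∷ false fe) inside) ,
     proj₂ (to (CoveredOnceAfter-∷ false p₁ true false sq fe) once) , suc-injective squares)
isTilingAfterᵇ-complete (suc zero) false p₁ k (false ∷ sq) (true ∷ fe) (inside , _ , _)
  with inside fzero refl
... | s≤s ()
isTilingAfterᵇ-complete (suc (suc zero)) false p₁ k (false ∷ sq) (true ∷ fe) (inside , _ , _)
  with inside fzero refl
... | s≤s (s≤s ())
isTilingAfterᵇ-complete (suc N) false p₁ zero (true ∷ sq) (false ∷ fe) (_ , _ , ())
isTilingAfterᵇ-complete (suc N) true p₁ k (true ∷ sq) (true ∷ fe) (_ , once , _) with once fzero
... | ()
isTilingAfterᵇ-complete (suc N) true p₁ k (true ∷ sq) (false ∷ fe) (_ , once , _) with once fzero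
... | ()
isTilingAfterᵇ-complete (suc N) true p₁ k (false ∷ sq) (true ∷ fe) (_ , once , _) with once fzero
... | ()
isTilingAfterᵇ-complete (suc N) false p₁ k (false ∷ sq) (false ∷ fe) (_ , once , _) with once fzero
... | ()
isTilingAfterᵇ-complete (suc N) false p₁ k (true ∷ sq) (true ∷ fe) (_ , once , _) with once fzero
... | ()

tilingsAfter : ℕ → Bool → Bool → ℕ → ℕ
tilingsAfter N p₀ p₁ k = ∑Pairs N λ sq fe → b2n (isTilingAfterᵇ N p₀ p₁ k sq fe)

numTilings≡tilingsAfter : ∀ N k → numTilings N k ≡ tilingsAfter N false false k
numTilings≡tilingsAfter N k =
  trans (length-filter≡∑ (isTilingWith? N k) (cartesianProduct (allVecs N) (allVecs N)))
  (trans (∑-cartesianProduct _ (allVecs N) (allVecs N))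
         (∑Pairs-cong N λ sq fe → cong b2n
            (does-⇔ (equivalence sq fe) (isTilingWith? N k (sq , fe))
                    (T? (isTilingAfterᵇ N false false k sq fe)))))
  where
  equivalence : ∀ sq fe → IsTilingWith N k (sq , fe) ⇔ T (isTilingAfterᵇ N false false k sq fe)
  equivalence sq fe = mk⇔
    (λ ((inside , once) , squares) → isTilingAfterᵇ-complete N false false k sq fe
      (inside , (λ c → trans (sym (cover≡coverAfter sq fe (toℕ c))) (once c)) , squares))
    (λ t → let inside , once , squares = isTilingAfterᵇ-sound N false false k sq fe t in
      (inside , λ c → trans (cover≡coverAfter sq fe (toℕ c)) (once c)) , squares)

tilingsAfter-post : ∀ N p₁ k → tilingsAfter (suc N) true p₁ k ≡ tilingsAfter N p₁ false k
tilingsAfter-post N p₁ k = ∑Pairs-∷ N _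

tilingsAfter-open : ∀ N p₁ k →
                    tilingsAfter (suc (suc (suc N))) false p₁ (suc k)
                    ≡ tilingsAfter (suc (suc N)) p₁ false k + tilingsAfter (suc (suc N)) p₁ true (suc k)
tilingsAfter-open N p₁ k =
  trans (∑Pairs-∷ (suc (suc N)) _)
  (trans (∑Pairs-cong (suc (suc N)) (λ x y → cong (_+_ (square x y)) (+-identityʳ (fence x y))))
         (sym (∑Pairs-+ (suc (suc N)) square fence)))
  where
  square fence : Vec Bool (suc (suc N)) → Vec Bool (suc (suc N)) → ℕ
  square x y = b2n (isTilingAfterᵇ (suc (suc N)) p₁ false k x y)
  fence  x y = b2n (isTilingAfterᵇ (suc (suc N)) p₁ true (suc k) x y)

tilingsAfter-open-zero : ∀ N p₁ →
                         tilingsAfter (suc (suc (suc N))) false p₁ zero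
                         ≡ tilingsAfter (suc (suc N)) p₁ true zero
tilingsAfter-open-zero N p₁ =
  trans (∑Pairs-∷ (suc (suc N)) _) (∑Pairs-cong (suc (suc N)) (λ x y → +-identityʳ _))

tilingsAfter-open-short : ∀ N p₁ k → fenceFits N ≡ false →
                          tilingsAfter (suc N) false p₁ (suc k) ≡ tilingsAfter N p₁ false k
tilingsAfter-open-short N p₁ k noFence =
  trans (∑Pairs-∷ N (λ x y → b2n (isTilingAfterᵇ (suc N) false p₁ (suc k) x y)))
        (∑Pairs-cong N λ x y →
          trans (cong (λ b → square x y + (b2n (b ∧ fence x y) + 0)) noFence)
                (+-identityʳ (square x y)))
  where
  square : Vec Bool N → Vec Bool N → ℕ
  square x y = b2n (isTilingAfterᵇ N p₁ false k x y)
  fence : Vec Bool N → Vec Bool N → Bool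
  fence x y = isTilingAfterᵇ N p₁ true (suc k) x y

-- State (false, true) means that cell 0 is the gap of a fence placed just left of the board.
tilingsAfter-gap : ∀ N k →
                   tilingsAfter (suc (suc (suc N))) false true (suc k)
                   ≡ tilingsAfter (suc N) false false k + tilingsAfter N false false (suc k)
tilingsAfter-gap N k =
  trans (tilingsAfter-open N true k)
        (cong₂ _+_ (tilingsAfter-post (suc N) false k)
                   (trans (tilingsAfter-post (suc N) true (suc k)) (tilingsAfter-post N false (suc k))))

tilingsAfter-gap-zero : ∀ N →
                        tilingsAfter (suc (suc (suc N))) false true zero ≡ tilingsAfter N false false zero
tilingsAfter-gap-zero N =
  trans (tilingsAfter-open-zero N true)
        (trans (tilingsAfter-post (suc N) true zero) (tilingsAfter-post N false zero))

-- blocks N k: tilings of the N-board by the three blocks of lengths 1, 3, 4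
-- (a square, a fence around a square, two interlocked fences) with k squares.
blocks : ℕ → ℕ → ℕ
blocks 0                         zero    = 1
blocks 0                         (suc k) = 0
blocks 1                         zero    = 0
blocks 1                         (suc k) = blocks 0 k
blocks 2                         zero    = 0
blocks 2                         (suc k) = blocks 1 k
blocks 3                         zero    = 0
blocks 3                         (suc k) = blocks 2 k + blocks 0 k
blocks (suc (suc (suc (suc N)))) zero    = blocks N zero
blocks (suc (suc (suc (suc N)))) (suc k) =
  blocks (suc (suc (suc N))) k + blocks (suc N) k + blocks N (suc k)

tilingsAfter≡blocks : ∀ N k → tilingsAfter N false false k ≡ blocks N k
tilingsAfter≡blocks 0 zero    = refl
tilingsAfter≡blocks 0 (suc k) = refl
tilingsAfter≡blocks 1 zero    = refl
tilingsAfter≡blocks 1 (suc k) = trans (tilingsAfter-open-short 0 false k refl) (tilingsAfter≡blocks 0 k)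
tilingsAfter≡blocks 2 zero    = refl
tilingsAfter≡blocks 2 (suc k) = trans (tilingsAfter-open-short 1 false k refl) (tilingsAfter≡blocks 1 k)
tilingsAfter≡blocks 3 zero    = refl
tilingsAfter≡blocks 3 (suc k) =
  trans (tilingsAfter-open 0 false k)
        (cong₂ _+_ (tilingsAfter≡blocks 2 k)
                   (trans (tilingsAfter-open-short 1 true k refl)
                          (trans (tilingsAfter-post 0 false k) (tilingsAfter≡blocks 0 k))))
tilingsAfter≡blocks (suc (suc (suc (suc N)))) zero =
  trans (tilingsAfter-open-zero (suc N) false)
        (trans (tilingsAfter-gap-zero N) (tilingsAfter≡blocks N zero))
tilingsAfter≡blocks (suc (suc (suc (suc N)))) (suc k) = begin
  tilingsAfter (suc (suc (suc (suc N)))) false false (suc k)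
    ≡⟨ tilingsAfter-open (suc N) false k ⟩
  tilingsAfter (suc (suc (suc N))) false false k + tilingsAfter (suc (suc (suc N))) false true (suc k)
    ≡⟨ cong (_+_ (_)) (tilingsAfter-gap N k) ⟩
  tilingsAfter (suc (suc (suc N))) false false k
    + (tilingsAfter (suc N) false false k + tilingsAfter N false false (suc k))
    ≡⟨ sym (+-assoc (tilingsAfter (suc (suc (suc N))) false false k) _ _) ⟩
  tilingsAfter (suc (suc (suc N))) false false k + tilingsAfter (suc N) false false k
    + tilingsAfter N false false (suc k)
    ≡⟨ cong₂ _+_ (cong₂ _+_ (tilingsAfter≡blocks (suc (suc (suc N))) k)
                            (tilingsAfter≡blocks (suc N) k))
                 (tilingsAfter≡blocks N (suc k)) ⟩
  blocks (suc (suc (suc (suc N)))) (suc k) ∎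
  where open ≡-Reasoning

Cᵣ≡blocks : ∀ r n → Cᵣ r (+ n) ≡ blocks (suc (n + n)) (suc (r + r))
Cᵣ≡blocks r n =
  trans (numTilings≡tilingsAfter (suc (n + n)) (suc (r + r)))
        (tilingsAfter≡blocks (suc (n + n)) (suc (r + r)))

-- dominoes N k: tilings of the N-board by squares and dominoes with k squares.
dominoes : ℕ → ℕ → ℕ
dominoes 0             zero    = 1
dominoes 0             (suc k) = 0
dominoes 1             zero    = 0
dominoes 1             (suc k) = dominoes 0 k
dominoes (suc (suc N)) zero    = dominoes N zero
dominoes (suc (suc N)) (suc k) = dominoes (suc N) k + dominoes N (suc k)

blocks0≡dominoes0 : ∀ k → blocks 0 k ≡ dominoes 0 k
blocks0≡dominoes0 zero    = refl
blocks0≡dominoes0 (suc k) = refl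

blocks+blocks≡dominoes : ∀ N k → blocks (suc (suc N)) k + blocks N k ≡ dominoes (suc (suc N)) k
blocks+blocks≡dominoes 0 zero                = refl
blocks+blocks≡dominoes 0 (suc zero)          = refl
blocks+blocks≡dominoes 0 (suc (suc zero))    = refl
blocks+blocks≡dominoes 0 (suc (suc (suc k))) = refl
blocks+blocks≡dominoes 1 zero                = refl
blocks+blocks≡dominoes 1 (suc k) =
  cong₂ _+_ (blocks+blocks≡dominoes 0 k) (blocks0≡dominoes0 k)
blocks+blocks≡dominoes (suc (suc N)) zero =
  trans (+-comm (blocks N zero) _) (blocks+blocks≡dominoes N zero)
blocks+blocks≡dominoes (suc (suc N)) (suc k) = begin
  blocks (suc (suc (suc (suc N)))) (suc k) + blocks (suc (suc N)) (suc k)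
    ≡⟨ regroup (blocks (suc (suc (suc N))) k) (blocks (suc N) k) (blocks N (suc k)) _ ⟩
  (blocks (suc (suc (suc N))) k + blocks (suc N) k) + (blocks (suc (suc N)) (suc k) + blocks N (suc k))
    ≡⟨ cong₂ _+_ (blocks+blocks≡dominoes (suc N) k) (blocks+blocks≡dominoes N (suc k)) ⟩
  dominoes (suc (suc (suc (suc N)))) (suc k) ∎
  where
  open ≡-Reasoning
  regroup : ∀ a b c d → a + b + c + d ≡ (a + b) + (d + c)
  regroup = solve-∀

dominoes-tooManySquares : ∀ N j → dominoes N (suc (N + j)) ≡ 0
dominoes-tooManySquares 0             j = refl
dominoes-tooManySquares 1             j = refl
dominoes-tooManySquares (suc (suc N)) j =
  cong₂ _+_ (dominoes-tooManySquares (suc N) j)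
            (trans (cong (λ m → dominoes N (suc m)) (shift N j))
                   (dominoes-tooManySquares N (suc (suc j))))
  where
  shift : ∀ N j → suc (suc (N + j)) ≡ N + suc (suc j)
  shift = solve-∀

dominoes-onlySquares : ∀ k → dominoes k k ≡ 1
dominoes-onlySquares 0             = refl
dominoes-onlySquares 1             = refl
dominoes-onlySquares (suc (suc k)) =
  cong₂ _+_ (dominoes-onlySquares (suc k))
            (trans (cong (λ m → dominoes k (suc m)) (+-comm 1 k)) (dominoes-tooManySquares k 1))

dominoes-onlyDominoes : ∀ d → dominoes (d + d) 0 ≡ 1
dominoes-onlyDominoes zero    = refl
dominoes-onlyDominoes (suc d) =
  trans (cong (λ m → dominoes (suc m) 0) (+-suc d d)) (dominoes-onlyDominoes d)

dominoes≡C : ∀ k d → dominoes (k + (d + d)) k ≡ (k + d) C k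
dominoes≡C zero    d    = dominoes-onlyDominoes d
dominoes≡C (suc k) zero = begin
  dominoes (suc k + 0) (suc k) ≡⟨ cong (λ m → dominoes m (suc k)) (+-identityʳ (suc k)) ⟩
  dominoes (suc k) (suc k)     ≡⟨ dominoes-onlySquares (suc k) ⟩
  1                            ≡⟨ sym (nCn≡1 (suc k)) ⟩
  suc k C suc k                ≡⟨ cong (_C suc k) (sym (+-identityʳ (suc k))) ⟩
  (suc k + 0) C suc k          ∎
  where open ≡-Reasoning
dominoes≡C (suc k) (suc d) = begin
  dominoes (suc k + (suc d + suc d)) (suc k)
    ≡⟨ cong (λ m → dominoes m (suc k)) (shift₁ k d) ⟩
  dominoes (suc (suc k + (d + d))) k + dominoes (suc k + (d + d)) (suc k)
    ≡⟨ cong₂ _+_ (trans (cong (λ m → dominoes m k) (shift₂ k d)) (dominoes≡C k (suc d)))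
                 (dominoes≡C (suc k) d) ⟩
  (k + suc d) C k + (suc k + d) C suc k
    ≡⟨ cong (λ m → (k + suc d) C k + m C suc k) (sym (+-suc k d)) ⟩
  (k + suc d) C k + (k + suc d) C suc k
    ≡⟨ nCk+nC[k+1]≡[n+1]C[k+1] (k + suc d) k ⟩
  suc (k + suc d) C suc k ∎
  where
  open ≡-Reasoning
  shift₁ : ∀ k d → suc k + (suc d + suc d) ≡ suc (suc (suc k + (d + d)))
  shift₁ = solve-∀
  shift₂ : ∀ k d → suc (suc k + (d + d)) ≡ k + (suc d + suc d)
  shift₂ = solve-∀

dominoes-even : ∀ n r → r ≤ n → dominoes (n + n) (r + r) ≡ (n + r) C (2 * r)
dominoes-even n r r≤n with m≤n⇒∃[o]m+o≡n r≤n
... | d , refl = begin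
  dominoes ((r + d) + (r + d)) (r + r) ≡⟨ cong (λ m → dominoes m (r + r)) (e₁ r d) ⟩
  dominoes ((r + r) + (d + d)) (r + r) ≡⟨ dominoes≡C (r + r) d ⟩
  ((r + r) + d) C (r + r)             ≡⟨ cong₂ _C_ (e₂ r d) (e₃ r) ⟩
  ((r + d) + r) C (2 * r)             ∎
  where
  open ≡-Reasoning
  e₁ : ∀ r d → (r + d) + (r + d) ≡ (r + r) + (d + d)
  e₁ = solve-∀
  e₂ : ∀ r d → (r + r) + d ≡ (r + d) + r
  e₂ = solve-∀
  e₃ : ∀ r → r + r ≡ 2 * r
  e₃ = solve-∀

blocks-odd : ∀ N k → blocks (suc (4 + N)) (suc k) ≡ blocks (suc N) (suc k) + dominoes (4 + N) k
blocks-odd N k =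
  trans (+-comm (blocks (4 + N) k + blocks (2 + N) k) _)
        (cong (_+_ (blocks (suc N) (suc k))) (blocks+blocks≡dominoes (2 + N) k))

Cᵣ-recurrence : ∀ r n → Cᵣ r (+ n) ≡ Cᵣ r (+ n - + 2) + dominoes (n + n) (r + r)
Cᵣ-recurrence r 0 = trans (Cᵣ≡blocks r 0) (blocks0≡dominoes0 (r + r))
Cᵣ-recurrence r 1 = trans (Cᵣ≡blocks r 1) (blocks+blocks≡dominoes 0 (r + r))
Cᵣ-recurrence r (suc (suc m)) = begin
  Cᵣ r (+ suc (suc m))
    ≡⟨ Cᵣ≡blocks r (suc (suc m)) ⟩
  blocks (suc (suc (suc m) + suc (suc m))) (suc (r + r))
    ≡⟨ cong (λ N → blocks (suc N) (suc (r + r))) (double m) ⟩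
  blocks (suc (4 + (m + m))) (suc (r + r))
    ≡⟨ blocks-odd (m + m) (r + r) ⟩
  blocks (suc (m + m)) (suc (r + r)) + dominoes (4 + (m + m)) (r + r)
    ≡⟨ cong₂ _+_ (sym (Cᵣ≡blocks r m)) (cong (λ N → dominoes N (r + r)) (sym (double m))) ⟩
  Cᵣ r (+ m) + dominoes (suc (suc m) + suc (suc m)) (r + r) ∎
  where
  open ≡-Reasoning
  double : ∀ m → suc (suc m) + suc (suc m) ≡ 4 + (m + m)
  double = solve-∀

lemma3p5 : (n r : ℕ) → r ≤ n →
    Cᵣ r (+ n) ≡ Cᵣ r (+ n - + 2) + (n + r) C (2 * r)
lemma3p5 n r r≤n =
  trans (Cᵣ-recurrence r n) (cong (_+_ (Cᵣ r (+ n - + 2))) (dominoes-even n r r≤n))
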